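{- Let $(A,+)$ be a finite cyclic group of order $n$ with generator $\alpha$, $(B,+)$ a finite abelian group, and $f:A\to B$ a surjective function that is an $(n,m,S)$ zero-difference function and almost balanced. Let $\lambda=\max_{x\in S}x$ and $\overline{\lambda}=\frac{1}{n-1}\sum_{\beta\in A\setminus\{0\}}\lambda_\beta$. Then the frequency-hopping sequence $\mathcal{T}=(f(i\alpha))_{i=0}^{n-1}$ is optimal if and only if $\lambda-\overline{\lambda}<1$.
   Context: $\lambda_\beta=|\{x\in A\mid f(x+\beta)=f(x)\}|$ for $\beta\in A\setminus\{0\}$; $f$ is an $(n,m,S)$ zero-difference function if $m=|f(A)|$ and $S=\{\lambda_\beta\mid\beta\neq0\}$. $f$ is almost balanced if, writing $n=km+\epsilon$ with $0\le\epsilon<m$, the preimage sizes $|f^{ -1}(b)|$, $b\in B$, equal $k$ for exactly $m-\epsilon$ values of $b$ and $k+1$ for the other $\epsilon$ values. For a sequence $X=(x_i)_{i=0}^{n-1}$, $H_{X,X}(t)=\sum_{i=0}^{n-1}h[x_i,x_{(i+t)\bmod n}]$ with $h[a,b]=1$ if $a=b$ else $0$, and $H(X)=\max_{1\le t<n}H_{X,X}(t)$. A sequence of length $n$ over an alphabet of size $m$ is an optimal frequency-hopping sequence if $H(X)=\lceil\frac{(n-\epsilon)(n+\epsilon-m)}{m(n-1)}\rceil$ (a general lower bound), $\epsilon$ being the least nonnegative residue of $n$ mod $m$. -}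

module Defs where

open import Data.Nat using (ℕ; zero; suc; _+_; _*_; _∸_; _⊔_; _≤?_; NonZero)
open import Data.Nat.DivMod using (_mod_; _/_; _%_)
open import Data.Fin using (Fin; toℕ)
open import Data.Fin.Properties using (_≟_)
open import Data.List using (List; length; filter; map; foldr; allFin)
open import Data.Nat.ListAction using (sum)
open import Data.Integer using (+_)
open import Data.Rational using (ℚ; 0ℚ) renaming (_/_ to _/ℚ_)
open import Data.Product using (∃; _×_)
open import Relation.Binary.PropositionalEquality using (_≡_)
import Relation.Nullary

-- The cyclic group (A,+) of order n, modelled as ℤ/nℤ = Fin n with addition mod n.
addA : (n : ℕ) .{{_ : NonZero n}} → Fin n → Fin n → Fin n
addA n a b = (toℕ a + toℕ b) mod n

smul : (n : ℕ) .{{_ : NonZero n}} → ℕ → Fin n → Fin n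
smul n i a = (i * toℕ a) mod n

IsGenerator : (n : ℕ) .{{_ : NonZero n}} → Fin n → Set
IsGenerator n α = ∀ (x : Fin n) → ∃ λ (i : ℕ) → smul n i α ≡ x

Surjective : ∀ {n m} → (Fin n → Fin m) → Set
Surjective {n} {m} f = ∀ (b : Fin m) → ∃ λ (a : Fin n) → f a ≡ b

-- maximum of a list of naturals (0 for the empty list)
maxList : List ℕ → ℕ
maxList = foldr _⊔_ 0

nonzeroA : (n : ℕ) → List (Fin n)
nonzeroA n = filter (λ β → 1 ≤? toℕ β) (allFin n)

lambdaβ : (n m : ℕ) .{{_ : NonZero n}} → (Fin n → Fin m) → Fin n → ℕ
lambdaβ n m f β = length (filter (λ x → f (addA n x β) ≟ f x) (allFin n))

Sset : (n m : ℕ) .{{_ : NonZero n}} → (Fin n → Fin m) → List ℕ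
Sset n m f = map (lambdaβ n m f) (nonzeroA n)

lambdaMax : (n m : ℕ) .{{_ : NonZero n}} → (Fin n → Fin m) → ℕ
lambdaMax n m f = maxList (Sset n m f)

lambdaSum : (n m : ℕ) .{{_ : NonZero n}} → (Fin n → Fin m) → ℕ
lambdaSum n m f = sum (Sset n m f)

-- s / (n-1) as a rational (only meaningful for n ≥ 2)
divByPred : ℕ → ℕ → ℚ
divByPred (suc (suc k)) s = (+ s) /ℚ (suc k)
divByPred _ s = 0ℚ

lambdaAvg : (n m : ℕ) .{{_ : NonZero n}} → (Fin n → Fin m) → ℚ
lambdaAvg n m f = divByPred n (lambdaSum n m f)

preimageSize : ∀ {n m} → (Fin n → Fin m) → Fin m → ℕ
preimageSize {n} f b = length (filter (λ a → f a ≟ b) (allFin n))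

countPreimageSize : ∀ {n m} → (Fin n → Fin m) → ℕ → ℕ
countPreimageSize {n} {m} f c =
  length (filter (λ b → Data.Nat._≟_ (preimageSize f b) c) (allFin m))

-- almost balanced: n = k m + ε, 0 ≤ ε < m; |f⁻¹(b)| = k for exactly m-ε values b
-- and = k+1 for the other ε values
AlmostBalanced : (n m : ℕ) .{{_ : NonZero m}} → (Fin n → Fin m) → Set
AlmostBalanced n m f =
  (countPreimageSize f (n / m) ≡ m ∸ (n % m)) × (countPreimageSize f (suc (n / m)) ≡ n % m)

hh : ∀ {m} → Fin m → Fin m → ℕ
hh a b with a ≟ b
... | Relation.Nullary.yes _ = 1
... | Relation.Nullary.no _ = 0

Hcorr : (n m : ℕ) .{{_ : NonZero n}} → (Fin n → Fin m) → ℕ → ℕ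
Hcorr n m X t = sum (map (λ i → hh (X i) (X ((toℕ i + t) mod n))) (allFin n))

Hmax : (n m : ℕ) .{{_ : NonZero n}} → (Fin n → Fin m) → ℕ
Hmax n m X = maxList (map (λ t → Hcorr n m X (toℕ t)) (nonzeroA n))

ceilDiv : ℕ → (b : ℕ) .{{_ : NonZero b}} → ℕ
ceilDiv a b = (a + (b ∸ 1)) / b

-- the lower bound ⌈ (n-ε)(n+ε-m) / (m(n-1)) ⌉ with ε = n mod m (for n ≥ 2, m ≥ 1)
fhsBound : ℕ → ℕ → ℕ
fhsBound n@(suc (suc k)) m@(suc l) =
  ceilDiv ((n ∸ (n % m)) * ((n + (n % m)) ∸ m)) (m * suc k)
fhsBound _ _ = 0

OptimalFHS : (n m : ℕ) .{{_ : NonZero n}} → (Fin n → Fin m) → Set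
OptimalFHS n m X = Hmax n m X ≡ fhsBound n m

seqT : (n m : ℕ) .{{_ : NonZero n}} → (Fin n → Fin m) → Fin n → Fin n → Fin m
seqT n m f α i = f (smul n (toℕ i) α)

-- Multiplication by the generator α is an additive bijection of A fixing 0, so the
-- autocorrelation of T at shift t is λ_{tα} and H(T) = λ.  Counting the pairs
-- (x, β) with f (x + β) = f x by fibres gives Σ_β λ_β = Σ_b |f⁻¹(b)|², which for an
-- almost balanced f turns Σ_{β≠0} λ_β into (n − ε)(n + ε − m)/m.  The lower bound is
-- therefore ⌈λ̄⌉, and since λ ≥ λ̄, H(T) = ⌈λ̄⌉ exactly when λ − λ̄ < 1.
module Submission where

open import Defs

-- A separate scope, because the statement uses the rational _<_ and _/_.
module _ where

  open import Data.Bool using (true; false; if_then_else_)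
  open import Data.Fin using (Fin; zero; suc; toℕ; punchIn)
  open import Data.Fin.Permutation
    using (Permutation′; permutation; _⟨$⟩ʳ_; _⟨$⟩ˡ_; inverseʳ; remove; insert; insert-punchIn; insert-remove)
  open import Data.Fin.Properties using (_≟_; toℕ-fromℕ<; fromℕ<-cong; toℕ-injective; toℕ<n)
  open import Data.Integer as ℤ using (ℤ; +_)
  import Data.Integer.Properties as ℤ
  import Data.Integer.Tactic.RingSolver as ℤ-Solver
  open import Data.List using (List; []; _∷_; length; filter; map; allFin; tabulate)
  open import Data.List.Properties using (map-tabulate; tabulate-cong)
  open import Data.Nat as ℕ using (ℕ; zero; suc; _+_; _*_; _∸_; _≤_; _<_; _≤?_; NonZero; z≤n; s≤s; s≤s⁻¹)
  open import Data.Nat.DivMod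
  open import Data.Nat.ListAction using () renaming (sum to sumList)
  open import Data.Nat.Properties hiding (_≟_)
  open import Data.Nat.Tactic.RingSolver using (solve-∀)
  open import Data.Product using (proj₁; proj₂)
  open import Data.Rational as ℚ using (1ℚ)
  import Data.Rational.Properties as ℚ
  open import Data.Rational.Unnormalised as ℚᵘ using (mkℚᵘ; 1ℚᵘ)
  import Data.Rational.Unnormalised.Properties as ℚᵘ
  open import Function using (_∘_; _⇔_; mk⇔)
  open import Function.Construct.Composition using (_⇔-∘_)
  open import Relation.Binary.PropositionalEquality
  open import Relation.Nullary using (Dec; yes; no; does; contradiction; ¬_)
  open import Relation.Unary using (Pred; Decidable)
  open import Algebra.Properties.Semiring.Sum +-*-semiring
    using (sum; sum-syntax; sum-cong-≗; ∑-comm; ∑-distrib-+; *-distribʳ-sum; sum-replicate-zero; sum-permute)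

  -- Through does, so that 𝟙 (suc i ≟ suc j) computes to 𝟙 (i ≟ j).
  𝟙 : ∀ {p} {P : Set p} → Dec P → ℕ
  𝟙 d = if does d then 1 else 0

  sumList-tabulate : ∀ {n} (g : Fin n → ℕ) → sumList (tabulate g) ≡ sum g
  sumList-tabulate {zero} g = refl
  sumList-tabulate {suc n} g = cong (λ s → g zero + s) (sumList-tabulate (g ∘ suc))

  sumList-map-allFin : ∀ {n} (g : Fin n → ℕ) → sumList (map g (allFin n)) ≡ sum g
  sumList-map-allFin g = trans (cong sumList (map-tabulate (λ x → x) g)) (sumList-tabulate g)

  length-filter≡sum-𝟙 : ∀ {a p} {A : Set a} {P : Pred A p} (P? : Decidable P) (xs : List A) →
    length (filter P? xs) ≡ sumList (map (𝟙 ∘ P?) xs)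
  length-filter≡sum-𝟙 P? [] = refl
  length-filter≡sum-𝟙 P? (x ∷ xs) with does (P? x)
  ... | true = cong suc (length-filter≡sum-𝟙 P? xs)
  ... | false = length-filter≡sum-𝟙 P? xs

  count≡∑𝟙 : ∀ {n p} {P : Pred (Fin n) p} (P? : Decidable P) →
    length (filter P? (allFin n)) ≡ ∑[ x < n ] 𝟙 (P? x)
  count≡∑𝟙 {n} P? = trans (length-filter≡sum-𝟙 P? (allFin n)) (sumList-map-allFin (𝟙 ∘ P?))

  ∑-1 : ∀ n → ∑[ i < n ] 1 ≡ n
  ∑-1 zero = refl
  ∑-1 (suc n) = cong suc (∑-1 n)

  ∑-≤ : ∀ {n} (g : Fin n → ℕ) {c} → (∀ i → g i ≤ c) → ∑[ i < n ] g i ≤ n * c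
  ∑-≤ {zero} g _ = z≤n
  ∑-≤ {suc n} g g≤c = +-mono-≤ (g≤c zero) (∑-≤ (g ∘ suc) (g≤c ∘ suc))

  ∑≡n⇒all≡1 : ∀ {n} (g : Fin n → ℕ) → (∀ i → g i ≤ 1) → ∑[ i < n ] g i ≡ n → ∀ i → g i ≡ 1
  ∑≡n⇒all≡1 {suc n} g g≤1 ∑g≡1+n = λ
    { zero → g₀≡1
    ; (suc i) → ∑≡n⇒all≡1 (g ∘ suc) (g≤1 ∘ suc) rest≡n i }
    where
    rest : ℕ
    rest = ∑[ i < n ] g (suc i)
    rest≤n : rest ≤ n
    rest≤n = subst (rest ≤_) (*-identityʳ n) (∑-≤ (g ∘ suc) (g≤1 ∘ suc))
    g₀≡1 : g zero ≡ 1
    g₀≡1 = ≤-antisym (g≤1 zero) (+-cancelʳ-≤ n 1 (g zero)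
      (subst (_≤ g zero + n) ∑g≡1+n (+-monoʳ-≤ (g zero) rest≤n)))
    rest≡n : rest ≡ n
    rest≡n = suc-injective (trans (cong (_+ rest) (sym g₀≡1)) ∑g≡1+n)

  ∑-δ : ∀ {m} (c : Fin m) (g : Fin m → ℕ) → ∑[ b < m ] (𝟙 (c ≟ b) * g b) ≡ g c
  ∑-δ {suc m} zero g = trans (cong₂ _+_ (+-identityʳ (g zero)) (sum-replicate-zero m)) (+-identityʳ (g zero))
  ∑-δ {suc m} (suc c) g = ∑-δ c (g ∘ suc)

  ∑-fibres : ∀ {n m} (f : Fin n → Fin m) (g : Fin m → ℕ) →
    ∑[ x < n ] g (f x) ≡ ∑[ b < m ] (preimageSize f b * g b)
  ∑-fibres {n} {m} f g = begin
    ∑[ x < n ] g (f x)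
      ≡⟨ sum-cong-≗ (λ x → sym (∑-δ (f x) g)) ⟩
    ∑[ x < n ] ∑[ b < m ] (𝟙 (f x ≟ b) * g b)
      ≡⟨ ∑-comm (λ x b → 𝟙 (f x ≟ b) * g b) ⟩
    ∑[ b < m ] ∑[ x < n ] (𝟙 (f x ≟ b) * g b)
      ≡⟨ sum-cong-≗ (λ b → sym (*-distribʳ-sum (g b) (λ x → 𝟙 (f x ≟ b)))) ⟩
    ∑[ b < m ] ((∑[ x < n ] 𝟙 (f x ≟ b)) * g b)
      ≡⟨ sum-cong-≗ (λ b → cong (_* g b) (sym (count≡∑𝟙 (λ x → f x ≟ b)))) ⟩
    ∑[ b < m ] (preimageSize f b * g b) ∎
    where open ≡-Reasoning

  ∑-permute : ∀ {n} (π : Permutation′ n) (g : Fin n → ℕ) → ∑[ i < n ] g (π ⟨$⟩ʳ i) ≡ sum g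
  ∑-permute π g = sym (sum-permute g π)

  𝟙-refl : ∀ {m} (a : Fin m) → 𝟙 (a ≟ a) ≡ 1
  𝟙-refl a with a ≟ a
  ... | yes _ = refl
  ... | no a≢a = contradiction refl a≢a

  𝟙-disjoint : ∀ {p q} {P : Set p} {Q : Set q} → (P → ¬ Q) → (P? : Dec P) (Q? : Dec Q) → 𝟙 P? + 𝟙 Q? ≤ 1
  𝟙-disjoint P⇒¬Q (yes p) (yes q) = contradiction q (P⇒¬Q p)
  𝟙-disjoint _ (yes _) (no _) = ≤-refl
  𝟙-disjoint _ (no _) (yes _) = ≤-refl
  𝟙-disjoint _ (no _) (no _) = z≤n

  hh≡𝟙 : ∀ {m} (a b : Fin m) → hh a b ≡ 𝟙 (b ≟ a)
  hh≡𝟙 a b with a ≟ b | b ≟ a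
  ... | yes _ | yes _ = refl
  ... | no _ | no _ = refl
  ... | yes a≡b | no b≢a = contradiction (sym a≡b) b≢a
  ... | no a≢b | yes b≡a = contradiction (sym b≡a) a≢b

  ≤-maxList-tabulate : ∀ {n} (g : Fin n → ℕ) i → g i ≤ maxList (tabulate g)
  ≤-maxList-tabulate g zero = m≤m⊔n (g zero) _
  ≤-maxList-tabulate g (suc i) = ≤-trans (≤-maxList-tabulate (g ∘ suc) i) (m≤n⊔m (g zero) _)

  maxList-tabulate-lub : ∀ {n} (g : Fin n → ℕ) {c} → (∀ i → g i ≤ c) → maxList (tabulate g) ≤ c
  maxList-tabulate-lub {zero} g _ = z≤n
  maxList-tabulate-lub {suc n} g g≤c = ⊔-lub (g≤c zero) (maxList-tabulate-lub (g ∘ suc) (g≤c ∘ suc))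

  maxList-tabulate-permute : ∀ {n} (π : Permutation′ n) (g : Fin n → ℕ) →
    maxList (tabulate (λ i → g (π ⟨$⟩ʳ i))) ≡ maxList (tabulate g)
  maxList-tabulate-permute π g = ≤-antisym
    (maxList-tabulate-lub gπ (λ i → ≤-maxList-tabulate g (π ⟨$⟩ʳ i)))
    (maxList-tabulate-lub g (λ j → subst (_≤ maxList (tabulate gπ)) (cong g (inverseʳ π)) (gπ≤max (π ⟨$⟩ˡ j))))
    where
    gπ : Fin _ → ℕ
    gπ i = g (π ⟨$⟩ʳ i)
    gπ≤max : ∀ i → gπ i ≤ maxList (tabulate gπ)
    gπ≤max = ≤-maxList-tabulate gπ

  permute-suc : ∀ {n} (π : Permutation′ (suc n)) → π ⟨$⟩ʳ zero ≡ zero →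
    ∀ i → π ⟨$⟩ʳ suc i ≡ suc (remove zero π ⟨$⟩ʳ i)
  permute-suc π π0≡0 i = begin
    π ⟨$⟩ʳ suc i
      ≡⟨ insert-remove zero π (suc i) ⟨
    insert zero (π ⟨$⟩ʳ zero) (remove zero π) ⟨$⟩ʳ suc i
      ≡⟨ insert-punchIn zero (π ⟨$⟩ʳ zero) (remove zero π) i ⟩
    punchIn (π ⟨$⟩ʳ zero) (remove zero π ⟨$⟩ʳ i)
      ≡⟨ cong (λ z → punchIn z (remove zero π ⟨$⟩ʳ i)) π0≡0 ⟩
    suc (remove zero π ⟨$⟩ʳ i) ∎
    where open ≡-Reasoning

  maxList-nonzero-permute : ∀ {n} (π : Permutation′ (suc n)) → π ⟨$⟩ʳ zero ≡ zero → (g : Fin (suc n) → ℕ) →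
    maxList (tabulate (λ i → g (π ⟨$⟩ʳ suc i))) ≡ maxList (tabulate (g ∘ suc))
  maxList-nonzero-permute π π0≡0 g =
    trans (cong maxList (tabulate-cong (λ i → cong g (permute-suc π π0≡0 i))))
          (maxList-tabulate-permute (remove zero π) (g ∘ suc))

  map-nonzeroA : ∀ {a} {A : Set a} {n} (g : Fin (suc n) → A) → map g (nonzeroA (suc n)) ≡ tabulate (g ∘ suc)
  map-nonzeroA {n = n} g = trans (cong (map g) (filter-suc (λ i → i))) (map-tabulate suc g)
    where
    filter-suc : ∀ {k} (h : Fin k → Fin n) →
      filter (λ β → 1 ≤? toℕ β) (tabulate (λ i → suc (h i))) ≡ tabulate (λ i → suc (h i))
    filter-suc {zero} h = refl
    filter-suc {suc k} h = cong (suc (h zero) ∷_) (filter-suc (h ∘ suc))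

  module _ (n : ℕ) .{{_ : NonZero n}} where

    toℕ-mod : ∀ a → toℕ (a mod n) ≡ a % n
    toℕ-mod a = toℕ-fromℕ< _

    mod-cong : ∀ {a b} → a % n ≡ b % n → a mod n ≡ b mod n
    mod-cong e = fromℕ<-cong _ _ e _ _

    toℕ-mod-id : (x : Fin n) → toℕ x mod n ≡ x
    toℕ-mod-id x = toℕ-injective (trans (toℕ-mod (toℕ x)) (m<n⇒m%n≡m (toℕ<n x)))

    mod-+n : ∀ a → (a + n) mod n ≡ a mod n
    mod-+n a = mod-cong ([m+n]%n≡m%n a n)

    mod-absorbˡ-+ : ∀ a b → (toℕ (a mod n) + b) mod n ≡ (a + b) mod n
    mod-absorbˡ-+ a b = mod-cong (begin
      (toℕ (a mod n) + b) % n     ≡⟨ cong (λ z → (z + b) % n) (toℕ-mod a) ⟩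
      (a % n + b) % n             ≡⟨ %-distribˡ-+ (a % n) b n ⟩
      (a % n % n + b % n) % n     ≡⟨ cong (λ z → (z + b % n) % n) (m%n%n≡m%n a n) ⟩
      (a % n + b % n) % n         ≡⟨ %-distribˡ-+ a b n ⟨
      (a + b) % n                 ∎)
      where open ≡-Reasoning

    mod-absorbʳ-+ : ∀ a b → (a + toℕ (b mod n)) mod n ≡ (a + b) mod n
    mod-absorbʳ-+ a b = begin
      (a + toℕ (b mod n)) mod n   ≡⟨ cong (_mod n) (+-comm a _) ⟩
      (toℕ (b mod n) + a) mod n   ≡⟨ mod-absorbˡ-+ b a ⟩
      (b + a) mod n               ≡⟨ cong (_mod n) (+-comm b a) ⟩
      (a + b) mod n               ∎
      where open ≡-Reasoning

    mod-absorbˡ-* : ∀ a b → (toℕ (a mod n) * b) mod n ≡ (a * b) mod n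
    mod-absorbˡ-* a b = mod-cong (begin
      (toℕ (a mod n) * b) % n     ≡⟨ cong (λ z → (z * b) % n) (toℕ-mod a) ⟩
      (a % n * b) % n             ≡⟨ %-distribˡ-* (a % n) b n ⟩
      (a % n % n * (b % n)) % n   ≡⟨ cong (λ z → (z * (b % n)) % n) (m%n%n≡m%n a n) ⟩
      (a % n * (b % n)) % n       ≡⟨ %-distribˡ-* a b n ⟨
      (a * b) % n                 ∎)
      where open ≡-Reasoning

    mod-absorbʳ-* : ∀ a b → (a * toℕ (b mod n)) mod n ≡ (a * b) mod n
    mod-absorbʳ-* a b = begin
      (a * toℕ (b mod n)) mod n   ≡⟨ cong (_mod n) (*-comm a _) ⟩
      (toℕ (b mod n) * a) mod n   ≡⟨ mod-absorbˡ-* b a ⟩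
      (b * a) mod n               ≡⟨ cong (_mod n) (*-comm b a) ⟩
      (a * b) mod n               ∎
      where open ≡-Reasoning

    translation : Fin n → Permutation′ n
    translation x = permutation (addA n x) (λ y → (toℕ y + (n ∸ toℕ x)) mod n) add-sub sub-add
      where
      open ≡-Reasoning
      x+y+[n∸x]≡y+n : ∀ y → toℕ x + y + (n ∸ toℕ x) ≡ y + n
      x+y+[n∸x]≡y+n y = begin
        toℕ x + y + (n ∸ toℕ x)     ≡⟨ cong (_+ (n ∸ toℕ x)) (+-comm (toℕ x) y) ⟩
        y + toℕ x + (n ∸ toℕ x)     ≡⟨ +-assoc y (toℕ x) _ ⟩
        y + (toℕ x + (n ∸ toℕ x))   ≡⟨ cong (λ s → y + s) (m+[n∸m]≡n (<⇒≤ (toℕ<n x))) ⟩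
        y + n                       ∎
      add-sub : ∀ y → addA n x ((toℕ y + (n ∸ toℕ x)) mod n) ≡ y
      add-sub y = begin
        (toℕ x + toℕ ((toℕ y + (n ∸ toℕ x)) mod n)) mod n  ≡⟨ mod-absorbʳ-+ (toℕ x) _ ⟩
        (toℕ x + (toℕ y + (n ∸ toℕ x))) mod n              ≡⟨ cong (_mod n) (sym (+-assoc (toℕ x) (toℕ y) _)) ⟩
        (toℕ x + toℕ y + (n ∸ toℕ x)) mod n                ≡⟨ cong (_mod n) (x+y+[n∸x]≡y+n (toℕ y)) ⟩
        (toℕ y + n) mod n                                  ≡⟨ mod-+n (toℕ y) ⟩
        toℕ y mod n                                        ≡⟨ toℕ-mod-id y ⟩
        y                                                  ∎
      sub-add : ∀ β → (toℕ (addA n x β) + (n ∸ toℕ x)) mod n ≡ β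
      sub-add β = begin
        (toℕ ((toℕ x + toℕ β) mod n) + (n ∸ toℕ x)) mod n  ≡⟨ mod-absorbˡ-+ (toℕ x + toℕ β) _ ⟩
        (toℕ x + toℕ β + (n ∸ toℕ x)) mod n                ≡⟨ cong (_mod n) (x+y+[n∸x]≡y+n (toℕ β)) ⟩
        (toℕ β + n) mod n                                  ≡⟨ mod-+n (toℕ β) ⟩
        toℕ β mod n                                        ≡⟨ toℕ-mod-id β ⟩
        β                                                  ∎

    smul-addA : ∀ α i t → smul n (toℕ (addA n i t)) α ≡ addA n (smul n (toℕ i) α) (smul n (toℕ t) α)
    smul-addA α i t = begin
      (toℕ ((toℕ i + toℕ t) mod n) * toℕ α) mod n           ≡⟨ mod-absorbˡ-* (toℕ i + toℕ t) _ ⟩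
      ((toℕ i + toℕ t) * toℕ α) mod n                       ≡⟨ cong (_mod n) (*-distribʳ-+ (toℕ α) (toℕ i) _) ⟩
      (toℕ i * toℕ α + toℕ t * toℕ α) mod n                 ≡⟨ mod-absorbˡ-+ (toℕ i * toℕ α) _ ⟨
      (toℕ (smul n (toℕ i) α) + toℕ t * toℕ α) mod n        ≡⟨ mod-absorbʳ-+ (toℕ (smul n (toℕ i) α)) _ ⟨
      (toℕ (smul n (toℕ i) α) + toℕ (smul n (toℕ t) α)) mod n ∎
      where open ≡-Reasoning

    scaling : (α : Fin n) (u : ℕ) → smul n u α ≡ 1 mod n → Permutation′ n
    scaling α u uα≡1 = permutation (λ i → smul n (toℕ i) α) (λ x → (toℕ x * u) mod n) scale-unscale unscale-scale
      where
      open ≡-Reasoning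
      cancel : ∀ a → (a * (u * toℕ α)) mod n ≡ a mod n
      cancel a = begin
        (a * (u * toℕ α)) mod n       ≡⟨ mod-absorbʳ-* a (u * toℕ α) ⟨
        (a * toℕ (smul n u α)) mod n  ≡⟨ cong (λ z → (a * toℕ z) mod n) uα≡1 ⟩
        (a * toℕ (1 mod n)) mod n     ≡⟨ mod-absorbʳ-* a 1 ⟩
        (a * 1) mod n                 ≡⟨ cong (_mod n) (*-identityʳ a) ⟩
        a mod n                       ∎
      scale-unscale : ∀ y → smul n (toℕ ((toℕ y * u) mod n)) α ≡ y
      scale-unscale y = begin
        (toℕ ((toℕ y * u) mod n) * toℕ α) mod n  ≡⟨ mod-absorbˡ-* (toℕ y * u) _ ⟩
        (toℕ y * u * toℕ α) mod n                ≡⟨ cong (_mod n) (*-assoc (toℕ y) u _) ⟩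
        (toℕ y * (u * toℕ α)) mod n              ≡⟨ cancel (toℕ y) ⟩
        toℕ y mod n                              ≡⟨ toℕ-mod-id y ⟩
        y                                        ∎
      unscale-scale : ∀ x → (toℕ (smul n (toℕ x) α) * u) mod n ≡ x
      unscale-scale x = begin
        (toℕ ((toℕ x * toℕ α) mod n) * u) mod n  ≡⟨ mod-absorbˡ-* (toℕ x * toℕ α) _ ⟩
        (toℕ x * toℕ α * u) mod n                ≡⟨ cong (_mod n) (*-assoc (toℕ x) (toℕ α) u) ⟩
        (toℕ x * (toℕ α * u)) mod n              ≡⟨ cong (λ z → (toℕ x * z) mod n) (*-comm (toℕ α) u) ⟩
        (toℕ x * (u * toℕ α)) mod n              ≡⟨ cancel (toℕ x) ⟩
        toℕ x mod n                              ≡⟨ toℕ-mod-id x ⟩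
        x                                        ∎

  module _ {n m : ℕ} .{{_ : NonZero n}} (f : Fin n → Fin m) where

    Hcorr-seqT≡lambdaβ : (α : Fin n) (u : ℕ) (uα≡1 : smul n u α ≡ 1 mod n) (t : Fin n) →
      Hcorr n m (seqT n m f α) (toℕ t) ≡ lambdaβ n m f (smul n (toℕ t) α)
    Hcorr-seqT≡lambdaβ α u uα≡1 t = begin
      Hcorr n m (seqT n m f α) (toℕ t)
        ≡⟨ sumList-map-allFin (λ i → hh (f (σ i)) (f (σ (addA n i t)))) ⟩
      ∑[ i < n ] hh (f (σ i)) (f (σ (addA n i t)))
        ≡⟨ sum-cong-≗ (λ i → trans (hh≡𝟙 _ _) (cong (λ z → 𝟙 (f z ≟ f (σ i))) (smul-addA n α i t))) ⟩
      ∑[ i < n ] 𝟙 (f (addA n (σ i) (σ t)) ≟ f (σ i))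
        ≡⟨ ∑-permute (scaling n α u uα≡1) (λ x → 𝟙 (f (addA n x (σ t)) ≟ f x)) ⟩
      ∑[ x < n ] 𝟙 (f (addA n x (σ t)) ≟ f x)
        ≡⟨ count≡∑𝟙 (λ x → f (addA n x (σ t)) ≟ f x) ⟨
      lambdaβ n m f (σ t) ∎
      where
      open ≡-Reasoning
      σ : Fin n → Fin n
      σ i = smul n (toℕ i) α

    ∑-lambdaβ : ∑[ β < n ] lambdaβ n m f β ≡ ∑[ b < m ] (preimageSize f b * preimageSize f b)
    ∑-lambdaβ = begin
      ∑[ β < n ] lambdaβ n m f β
        ≡⟨ sum-cong-≗ (λ β → count≡∑𝟙 (λ x → f (addA n x β) ≟ f x)) ⟩
      ∑[ β < n ] ∑[ x < n ] 𝟙 (f (addA n x β) ≟ f x)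
        ≡⟨ ∑-comm (λ β x → 𝟙 (f (addA n x β) ≟ f x)) ⟩
      ∑[ x < n ] ∑[ β < n ] 𝟙 (f (addA n x β) ≟ f x)
        ≡⟨ sum-cong-≗ (λ x → ∑-permute (translation n x) (λ y → 𝟙 (f y ≟ f x))) ⟩
      ∑[ x < n ] ∑[ y < n ] 𝟙 (f y ≟ f x)
        ≡⟨ sum-cong-≗ (λ x → count≡∑𝟙 (λ y → f y ≟ f x)) ⟨
      ∑[ x < n ] preimageSize f (f x)
        ≡⟨ ∑-fibres f (preimageSize f) ⟩
      ∑[ b < m ] (preimageSize f b * preimageSize f b) ∎
      where open ≡-Reasoning

  module _ {n m : ℕ} (f : Fin (suc n) → Fin m) where

    lambdaSum-suc : lambdaSum (suc n) m f ≡ ∑[ j < n ] lambdaβ (suc n) m f (suc j)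
    lambdaSum-suc = trans (cong sumList (map-nonzeroA {n = n} (lambdaβ (suc n) m f)))
      (sumList-tabulate (λ j → lambdaβ (suc n) m f (suc j)))

    lambdaMax-suc : lambdaMax (suc n) m f ≡ maxList (tabulate (λ (j : Fin n) → lambdaβ (suc n) m f (suc j)))
    lambdaMax-suc = cong maxList (map-nonzeroA {n = n} (lambdaβ (suc n) m f))

    lambdaβ-zero : lambdaβ (suc n) m f zero ≡ suc n
    lambdaβ-zero = begin
      lambdaβ (suc n) m f zero
        ≡⟨ count≡∑𝟙 (λ x → f (addA (suc n) x zero) ≟ f x) ⟩
      ∑[ x < suc n ] 𝟙 (f (addA (suc n) x zero) ≟ f x)
        ≡⟨ sum-cong-≗ (λ x → trans (cong (λ z → 𝟙 (f z ≟ f x)) (x+0≡x x)) (𝟙-refl (f x))) ⟩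
      ∑[ x < suc n ] 1
        ≡⟨ ∑-1 (suc n) ⟩
      suc n ∎
      where
      open ≡-Reasoning
      x+0≡x : ∀ x → addA (suc n) x zero ≡ x
      x+0≡x x = trans (cong (_mod suc n) (+-identityʳ (toℕ x))) (toℕ-mod-id (suc n) x)

    lambdaSum+n≡∑preimageSize² : lambdaSum (suc n) m f + suc n ≡ ∑[ b < m ] (preimageSize f b * preimageSize f b)
    lambdaSum+n≡∑preimageSize² = begin
      lambdaSum (suc n) m f + suc n
        ≡⟨ cong (_+ suc n) lambdaSum-suc ⟩
      ∑[ j < n ] lambdaβ (suc n) m f (suc j) + suc n
        ≡⟨ +-comm _ (suc n) ⟩
      suc n + ∑[ j < n ] lambdaβ (suc n) m f (suc j)
        ≡⟨ cong (_+ ∑[ j < n ] lambdaβ (suc n) m f (suc j)) lambdaβ-zero ⟨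
      ∑[ β < suc n ] lambdaβ (suc n) m f β
        ≡⟨ ∑-lambdaβ f ⟩
      ∑[ b < m ] (preimageSize f b * preimageSize f b) ∎
      where open ≡-Reasoning

    lambdaSum≤lambdaMax*n : lambdaSum (suc n) m f ≤ lambdaMax (suc n) m f * n
    lambdaSum≤lambdaMax*n = subst₂ _≤_ (sym lambdaSum-suc) (trans (*-comm n _) (cong (_* n) (sym lambdaMax-suc)))
      (∑-≤ (λ j → lambdaβ (suc n) m f (suc j)) (≤-maxList-tabulate (λ j → lambdaβ (suc n) m f (suc j))))

    Hmax-seqT≡lambdaMax : (α : Fin (suc n)) → IsGenerator (suc n) α →
      Hmax (suc n) m (seqT (suc n) m f α) ≡ lambdaMax (suc n) m f
    Hmax-seqT≡lambdaMax α generates = begin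
      Hmax (suc n) m (seqT (suc n) m f α)
        ≡⟨ cong maxList (map-nonzeroA {n = n} (λ t → Hcorr (suc n) m (seqT (suc n) m f α) (toℕ t))) ⟩
      maxList (tabulate (λ (j : Fin n) → Hcorr (suc n) m (seqT (suc n) m f α) (toℕ (suc j))))
        ≡⟨ cong maxList (tabulate-cong {n = n} (λ j → Hcorr-seqT≡lambdaβ f α u uα≡1 (suc j))) ⟩
      maxList (tabulate (λ (j : Fin n) → lambdaβ (suc n) m f (π ⟨$⟩ʳ suc j)))
        ≡⟨ maxList-nonzero-permute π (toℕ-mod-id (suc n) zero) (lambdaβ (suc n) m f) ⟩
      maxList (tabulate (λ (j : Fin n) → lambdaβ (suc n) m f (suc j)))
        ≡⟨ lambdaMax-suc ⟨
      lambdaMax (suc n) m f ∎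
      where
      open ≡-Reasoning
      u : ℕ
      u = proj₁ (generates (1 mod suc n))
      uα≡1 : smul (suc n) u α ≡ 1 mod suc n
      uα≡1 = proj₂ (generates (1 mod suc n))
      π : Permutation′ (suc n)
      π = scaling (suc n) α u uα≡1

  square-k-or-suc-k : ∀ {x k} (x≟k : Dec (x ≡ k)) (x≟1+k : Dec (x ≡ suc k)) → 𝟙 x≟k + 𝟙 x≟1+k ≡ 1 →
    x * x ≡ 𝟙 x≟k * (k * k) + 𝟙 x≟1+k * (suc k * suc k)
  square-k-or-suc-k (yes refl) (yes x≡1+x) _ = contradiction (sym x≡1+x) 1+n≢n
  square-k-or-suc-k (yes refl) (no _) _ = sym (trans (+-identityʳ _) (+-identityʳ _))
  square-k-or-suc-k (no _) (yes refl) _ = sym (+-identityʳ _)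
  square-k-or-suc-k (no _) (no _) ()

  module _ {n m : ℕ} .{{_ : NonZero m}} (f : Fin n → Fin m) (balanced : AlmostBalanced n m f) where

    private
      k ε : ℕ
      k = n / m
      ε = n % m
      small? : ∀ b → Dec (preimageSize f b ≡ k)
      small? b = preimageSize f b ℕ.≟ k
      big? : ∀ b → Dec (preimageSize f b ≡ suc k)
      big? b = preimageSize f b ℕ.≟ suc k
      small big : Fin m → ℕ
      small = 𝟙 ∘ small?
      big = 𝟙 ∘ big?

    small+big≡1 : ∀ b → small b + big b ≡ 1
    small+big≡1 = ∑≡n⇒all≡1 (λ b → small b + big b) small+big≤1 (begin
      ∑[ b < m ] (small b + big b)                         ≡⟨ ∑-distrib-+ small big ⟩
      sum small + sum big                                  ≡⟨ cong₂ _+_ (count≡∑𝟙 small?) (count≡∑𝟙 big?) ⟨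
      countPreimageSize f k + countPreimageSize f (suc k)  ≡⟨ cong₂ _+_ (proj₁ balanced) (proj₂ balanced) ⟩
      (m ∸ ε) + ε                                          ≡⟨ m∸n+n≡m (m%n≤n n m) ⟩
      m                                                    ∎)
      where
      open ≡-Reasoning
      small+big≤1 : ∀ b → small b + big b ≤ 1
      small+big≤1 b = 𝟙-disjoint (λ x≡k x≡1+k → 1+n≢n (trans (sym x≡1+k) x≡k)) (small? b) (big? b)

    ∑preimageSize²-balanced :
      ∑[ b < m ] (preimageSize f b * preimageSize f b) ≡ (m ∸ ε) * (k * k) + ε * (suc k * suc k)
    ∑preimageSize²-balanced = begin
      ∑[ b < m ] (preimageSize f b * preimageSize f b)
        ≡⟨ sum-cong-≗ (λ b → square-k-or-suc-k (small? b) (big? b) (small+big≡1 b)) ⟩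
      ∑[ b < m ] (small b * (k * k) + big b * (suc k * suc k))
        ≡⟨ ∑-distrib-+ (λ b → small b * (k * k)) _ ⟩
      ∑[ b < m ] (small b * (k * k)) + ∑[ b < m ] (big b * (suc k * suc k))
        ≡⟨ cong₂ _+_ (*-distribʳ-sum (k * k) small) (*-distribʳ-sum (suc k * suc k) big) ⟨
      sum small * (k * k) + sum big * (suc k * suc k)
        ≡⟨ cong₂ (λ a c → a * (k * k) + c * (suc k * suc k)) small-count big-count ⟩
      (m ∸ ε) * (k * k) + ε * (suc k * suc k) ∎
      where
      open ≡-Reasoning
      small-count : sum small ≡ m ∸ ε
      small-count = trans (sym (count≡∑𝟙 small?)) (proj₁ balanced)
      big-count : sum big ≡ ε
      big-count = trans (sym (count≡∑𝟙 big?)) (proj₂ balanced)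

  -- Both sides reduce to k·m·(n + ε − m); writing S as k(n + ε) ∸ k·m avoids a case split on k = 0.
  balanced-numerator : ∀ {n k m ε S} → n ≡ ε + k * m → ε ≤ m →
    S + n ≡ (m ∸ ε) * (k * k) + ε * (suc k * suc k) → S * m ≡ (n ∸ ε) * ((n + ε) ∸ m)
  balanced-numerator {k = k} {m} {ε} {S} refl ε≤m S+n≡ = begin
    S * m                                    ≡⟨ cong (_* m) S≡ ⟩
    k * (ε + k * m + ε ∸ m) * m              ≡⟨ *-assoc k _ m ⟩
    k * ((ε + k * m + ε ∸ m) * m)            ≡⟨ cong (k *_) (*-comm _ m) ⟩
    k * (m * (ε + k * m + ε ∸ m))            ≡⟨ *-assoc k m _ ⟨
    k * m * (ε + k * m + ε ∸ m)              ≡⟨ cong (_* (ε + k * m + ε ∸ m)) (m+n∸m≡n ε (k * m)) ⟨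
    (ε + k * m ∸ ε) * (ε + k * m + ε ∸ m)    ∎
    where
    open ≡-Reasoning
    ∑squares : (m ∸ ε) * (k * k) + ε * (suc k * suc k) ≡ k * (ε + k * m + ε) + ε
    ∑squares = trans (expand k (m ∸ ε) ε) (cong (λ z → k * (ε + k * z + ε) + ε) (m∸n+n≡m ε≤m))
      where
      expand : ∀ k r ε → r * (k * k) + ε * (suc k * suc k) ≡ k * (ε + k * (r + ε) + ε) + ε
      expand = solve-∀
    S+km≡ : S + k * m ≡ k * (ε + k * m + ε)
    S+km≡ = +-cancelʳ-≡ ε _ _ (trans (reassoc S (k * m) ε) (trans S+n≡ ∑squares))
      where
      reassoc : ∀ S a ε → S + a + ε ≡ S + (ε + a)
      reassoc = solve-∀
    S≡ : S ≡ k * (ε + k * m + ε ∸ m)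
    S≡ = begin
      S                               ≡⟨ m+n∸n≡m S (k * m) ⟨
      S + k * m ∸ k * m               ≡⟨ cong (_∸ k * m) S+km≡ ⟩
      k * (ε + k * m + ε) ∸ k * m     ≡⟨ *-distribˡ-∸ k _ m ⟨
      k * (ε + k * m + ε ∸ m)         ∎

  lambdaSum*m≡fhsNumerator : ∀ {n m} .{{_ : NonZero m}} (f : Fin (suc n) → Fin m) →
    AlmostBalanced (suc n) m f →
    lambdaSum (suc n) m f * m ≡ (suc n ∸ suc n % m) * ((suc n + suc n % m) ∸ m)
  lambdaSum*m≡fhsNumerator {n} {m} f balanced =
    balanced-numerator {k = suc n / m} (m≡m%n+[m/n]*n (suc n) m) (m%n≤n (suc n) m)
      (trans (lambdaSum+n≡∑preimageSize² f) (∑preimageSize²-balanced f balanced))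

  ceilDiv≡⇔ : ∀ a p c → a ≤ c * suc p → (ceilDiv a (suc p) ≡ c) ⇔ (c * suc p < a + suc p)
  ceilDiv≡⇔ a p c a≤cb = mk⇔ to from
    where
    b : ℕ
    b = suc p
    a+b≡1+a+p : a + b ≡ suc (a + p)
    a+b≡1+a+p = +-suc a p
    to : (a + p) / b ≡ c → c * b < a + b
    to refl = subst ((a + p) / b * b <_) (sym a+b≡1+a+p) (s≤s (m/n*n≤m (a + p) b))
    from : c * b < a + b → (a + p) / b ≡ c
    from cb<a+b = ≤-antisym upper lower
      where
      lower : c ≤ (a + p) / b
      lower = subst (_≤ (a + p) / b) (m*n/n≡m c b) (/-monoˡ-≤ b (s≤s⁻¹ (subst (c * b <_) a+b≡1+a+p cb<a+b)))
      upper : (a + p) / b ≤ c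
      upper = s≤s⁻¹ (m<n*o⇒m/o<n (subst (a + p <_) (+-comm (c * b) b) (+-mono-≤-< a≤cb (n<1+n p))))

  ceilDiv-scaled≡⇔ : ∀ S L l k → S ≤ L * suc k →
    (ceilDiv (S * suc l) (suc l * suc k) ≡ L) ⇔ (L * suc k < S + suc k)
  ceilDiv-scaled≡⇔ S L l k S≤Ld = cancel-m ⇔-∘ ceilDiv≡⇔ (S * m) _ L Sm≤Lmd
    where
    m d : ℕ
    m = suc l
    d = suc k
    L[md]≡m[Ld] : L * (m * d) ≡ m * (L * d)
    L[md]≡m[Ld] = trans (sym (*-assoc L m d)) (trans (cong (_* d) (*-comm L m)) (*-assoc m L d))
    Sm+md≡m[S+d] : S * m + m * d ≡ m * (S + d)
    Sm+md≡m[S+d] = trans (cong (_+ m * d) (*-comm S m)) (sym (*-distribˡ-+ m S d))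
    Sm≤Lmd : S * m ≤ L * (m * d)
    Sm≤Lmd = subst₂ _≤_ (*-comm m S) (sym L[md]≡m[Ld]) (*-monoʳ-≤ m S≤Ld)
    cancel-m : (L * (m * d) < S * m + m * d) ⇔ (L * d < S + d)
    cancel-m = mk⇔
      (λ lt → *-cancelˡ-< m (L * d) (S + d) (subst₂ _<_ L[md]≡m[Ld] Sm+md≡m[S+d] lt))
      (λ lt → subst₂ _<_ (sym L[md]≡m[Ld]) (sym Sm+md≡m[S+d]) (*-monoʳ-< m lt))

  unnormalised-minus<1⇔ : ∀ L S k → (mkℚᵘ (+ L) 0 ℚᵘ.- mkℚᵘ (+ S) k ℚᵘ.< 1ℚᵘ) ⇔ (L * suc k < S + suc k)
  unnormalised-minus<1⇔ L S k = mk⇔ to from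
    where
    d : ℕ
    d = suc k
    numerator : ℤ
    numerator = + L ℤ.* + d ℤ.+ (ℤ.- (+ S)) ℤ.* + 1
    numerator+S : numerator ℤ.+ + S ≡ + (L * d)
    numerator+S = trans (cancel (+ L) (+ d) (+ S)) (sym (ℤ.pos-* L d))
      where
      cancel : ∀ x y z → x ℤ.* y ℤ.+ (ℤ.- z) ℤ.* + 1 ℤ.+ z ≡ x ℤ.* y
      cancel = ℤ-Solver.solve-∀
    Ld-S≡numerator : + (L * d) ℤ.+ ℤ.- (+ S) ≡ numerator
    Ld-S≡numerator = trans (cong (ℤ._+ ℤ.- (+ S)) (ℤ.pos-* L d)) (times-one (+ L) (+ d) (+ S))
      where
      times-one : ∀ x y z → x ℤ.* y ℤ.+ (ℤ.- z) ≡ x ℤ.* y ℤ.+ (ℤ.- z) ℤ.* + 1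
      times-one = ℤ-Solver.solve-∀
    S+d-S≡d : + (S + d) ℤ.+ ℤ.- (+ S) ≡ + d
    S+d-S≡d = trans (cong (ℤ._+ ℤ.- (+ S)) (ℤ.pos-+ S d)) (cancel (+ S) (+ d))
      where
      cancel : ∀ x y → x ℤ.+ y ℤ.+ ℤ.- x ≡ y
      cancel = ℤ-Solver.solve-∀
    denominator : + suc (k + 0) ≡ + d
    denominator = cong (λ z → + suc z) (+-identityʳ k)
    to : mkℚᵘ (+ L) 0 ℚᵘ.- mkℚᵘ (+ S) k ℚᵘ.< 1ℚᵘ → L * d < S + d
    to (ℚᵘ.*<* lt) = ℤ.drop‿+<+ (subst₂ ℤ._<_ numerator+S (trans (ℤ.+-comm (+ d) (+ S)) (sym (ℤ.pos-+ S d)))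
      (ℤ.+-monoˡ-< (+ S) (subst₂ ℤ._<_ (ℤ.*-identityʳ numerator) (trans (ℤ.*-identityˡ _) denominator) lt)))
    from : L * d < S + d → mkℚᵘ (+ L) 0 ℚᵘ.- mkℚᵘ (+ S) k ℚᵘ.< 1ℚᵘ
    from lt = ℚᵘ.*<* (subst₂ ℤ._<_ (sym (ℤ.*-identityʳ numerator)) (sym (trans (ℤ.*-identityˡ _) denominator))
      (subst₂ ℤ._<_ Ld-S≡numerator S+d-S≡d (ℤ.+-monoˡ-< (ℤ.- (+ S)) (ℤ.+<+ lt))))

  toℚᵘ-integer-minus-fraction : ∀ L S k →
    ℚ.toℚᵘ ((+ L) ℚ./ 1 ℚ.- (+ S) ℚ./ suc k) ℚᵘ.≃ mkℚᵘ (+ L) 0 ℚᵘ.- mkℚᵘ (+ S) k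
  toℚᵘ-integer-minus-fraction L S k = ℚᵘ.≃-trans (ℚ.toℚᵘ-homo-+ ((+ L) ℚ./ 1) (ℚ.- ((+ S) ℚ./ suc k)))
    (ℚᵘ.+-cong (ℚ.toℚᵘ-fromℚᵘ (mkℚᵘ (+ L) 0))
      (ℚᵘ.≃-trans (ℚ.toℚᵘ-homo‿- ((+ S) ℚ./ suc k)) (ℚᵘ.-‿cong (ℚ.toℚᵘ-fromℚᵘ (mkℚᵘ (+ S) k)))))

  -- ℚ._/_ normalises, so the comparison is made between unnormalised representatives.
  integer-minus-fraction<1⇔ : ∀ L S k → ((+ L) ℚ./ 1 ℚ.- (+ S) ℚ./ suc k ℚ.< 1ℚ) ⇔ (L * suc k < S + suc k)
  integer-minus-fraction<1⇔ L S k = unnormalised-minus<1⇔ L S k ⇔-∘ mk⇔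
    (λ lt → ℚᵘ.<-respˡ-≃ (toℚᵘ-integer-minus-fraction L S k) (ℚ.toℚᵘ-mono-< lt))
    (λ lt → ℚ.toℚᵘ-cancel-< (ℚᵘ.<-respˡ-≃ (ℚᵘ.≃-sym (toℚᵘ-integer-minus-fraction L S k)) lt))

open import Data.Nat using (ℕ; _≤_; NonZero; zero; suc; s≤s; _*_)
open import Data.Fin using (Fin)
open import Data.Rational using (_<_; _-_; 1ℚ; _/_)
open import Data.Integer using (+_)
open import Function using (_⇔_; mk⇔)
open import Function.Construct.Composition using (_⇔-∘_)
open import Function.Construct.Symmetry using (⇔-sym)
open import Relation.Binary.PropositionalEquality using (_≡_; sym; trans; cong)

theorem10 : (n m : ℕ) .{{_ : NonZero n}} .{{_ : NonZero m}} → 2 ≤ n →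
    (α : Fin n) → IsGenerator n α →
    (f : Fin n → Fin m) → Surjective f → AlmostBalanced n m f →
    (OptimalFHS n m (seqT n m f α) ⇔ (((+ lambdaMax n m f) / 1) - lambdaAvg n m f < 1ℚ))
theorem10 _ zero {{_}} {{()}}
theorem10 n@(suc (suc k)) m@(suc l) (s≤s (s≤s _)) α generates f _ balanced =
  ⇔-sym (integer-minus-fraction<1⇔ L S k)
    ⇔-∘ (ceilDiv-scaled≡⇔ S L l k (lambdaSum≤lambdaMax*n f) ⇔-∘ optimal⇔)
  where
  L S : ℕ
  L = lambdaMax n m f
  S = lambdaSum n m f
  H≡L : Hmax n m (seqT n m f α) ≡ L
  H≡L = Hmax-seqT≡lambdaMax f α generates
  bound≡ : fhsBound n m ≡ ceilDiv (S * m) (m * suc k)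
  bound≡ = cong (λ a → ceilDiv a (m * suc k)) (sym (lambdaSum*m≡fhsNumerator f balanced))
  optimal⇔ : OptimalFHS n m (seqT n m f α) ⇔ (ceilDiv (S * m) (m * suc k) ≡ L)
  optimal⇔ = mk⇔ (λ H≡bound → trans (sym bound≡) (trans (sym H≡bound) H≡L))
                 (λ bound≡L → trans H≡L (trans (sym bound≡L) (sym bound≡)))
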